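{- If $\mathcal{M}$ is a uniform oriented matroid with $\operatorname{rank}(\mathcal{M})\ge4$ and $\operatorname{corank}(\mathcal{M})\ge2$, then $\mathcal{M}$ contains a minor isomorphic to the alternating oriented matroid $C^{6,4}$.
   Context: An oriented matroid of rank $d$ on $E$ is uniform if the supports of its circuits are exactly the $(d+1)$-element subsets of $E$; corank $=|E|-\operatorname{rank}$. A minor is obtained by a sequence of deletions and contractions. $C^{n,d}$ is the oriented matroid of linear dependencies of vectors $\mathbf{v}_1,\dots,\mathbf{v}_n\in\mathbb{R}^d$ all of whose maximal $d\times d$ minors are strictly positive. Two oriented matroids are isomorphic if one is obtained from the other by reorientations (flipping the sign of an element in all circuits) followed by relabeling the ground set. -}

module Defs where

open import Data.Nat using (ℕ; zero; suc; _^_)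
open import Data.Bool using (Bool; true; false; not)
open import Data.Fin using (Fin; toℕ)
open import Data.Fin.Subset using (Subset; ∣_∣)
open import Data.Integer as ℤ using (ℤ; +_; -[1+_])
open import Data.Vec using (Vec; []; _∷_; lookup; map; insertAt; tabulate; foldr)
open import Data.Product using (Σ; ∃; _×_; _,_)
open import Data.Sum using (_⊎_)
open import Data.Empty using (⊥)
open import Relation.Nullary using (¬_)
open import Relation.Binary.PropositionalEquality using (_≡_; _≢_)
open import Function.Bundles using (_⇔_; _↔_)
open import Function.Bundles using (Inverse)

data Sign : Set where
  − 𝟘 ＋ : Sign

neg : Sign → Sign
neg − = ＋
neg 𝟘 = 𝟘
neg ＋ = −

SignVec : ℕ → Set
SignVec n = Vec Sign n

zeroVec : ∀ {n} → SignVec n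
zeroVec {n} = tabulate (λ _ → 𝟘)

negVec : ∀ {n} → SignVec n → SignVec n
negVec = map neg

isNonzero : Sign → Bool
isNonzero 𝟘 = false
isNonzero _ = true

supp : ∀ {n} → SignVec n → Subset n
supp = map isNonzero

_⊑_ : ∀ {n} → SignVec n → SignVec n → Set
_⊑_ {n} X Y = ∀ (i : Fin n) → lookup X i ≢ 𝟘 → lookup Y i ≢ 𝟘

SetOfSignVecs : ℕ → Set₁
SetOfSignVecs n = SignVec n → Set

record IsOrientedMatroid {n : ℕ} (𝒞 : SetOfSignVecs n) : Set where
  field
    C0 : ¬ 𝒞 zeroVec
    C1 : ∀ X → 𝒞 X → 𝒞 (negVec X)
    C2 : ∀ X Y → 𝒞 X → 𝒞 Y → X ⊑ Y → (X ≡ Y) ⊎ (X ≡ negVec Y)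
    C3 : ∀ X Y (e : Fin n) → 𝒞 X → 𝒞 Y → X ≢ negVec Y →
         lookup X e ≡ ＋ → lookup Y e ≡ − →
         ∃ λ Z → 𝒞 Z × lookup Z e ≡ 𝟘 ×
           (∀ i → lookup Z i ≡ ＋ → (lookup X i ≡ ＋) ⊎ (lookup Y i ≡ ＋)) ×
           (∀ i → lookup Z i ≡ − → (lookup X i ≡ −) ⊎ (lookup Y i ≡ −))

record OrientedMatroid (n : ℕ) : Set₁ where
  field
    Circuit : SetOfSignVecs n
    isOM    : IsOrientedMatroid Circuit
open OrientedMatroid public

IsUniformOfRank : ∀ {n} → ℕ → OrientedMatroid n → Set
IsUniformOfRank {n} d M =
  ∀ (S : Subset n) → (∣ S ∣ ≡ suc d) ⇔ (∃ λ X → Circuit M X × supp X ≡ S)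

deleteC : ∀ {n} → Fin (suc n) → SetOfSignVecs (suc n) → SetOfSignVecs n
deleteC e 𝒞 X = 𝒞 (insertAt X e 𝟘)

restrictsFrom : ∀ {n} → Fin (suc n) → SetOfSignVecs (suc n) → SetOfSignVecs n
restrictsFrom e 𝒞 X = ∃ λ s → 𝒞 (insertAt X e s)

contractC : ∀ {n} → Fin (suc n) → SetOfSignVecs (suc n) → SetOfSignVecs n
contractC e 𝒞 X =
  restrictsFrom e 𝒞 X × X ≢ zeroVec ×
  (∀ Y → restrictsFrom e 𝒞 Y → Y ≢ zeroVec → Y ⊑ X → X ⊑ Y)

data IsMinor {n : ℕ} (𝒞 : SetOfSignVecs n) : {m : ℕ} → SetOfSignVecs m → Set₁ where
  self : IsMinor 𝒞 𝒞
  del  : ∀ {m} {𝒟 : SetOfSignVecs (suc m)} → IsMinor 𝒞 𝒟 →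
         (e : Fin (suc m)) → IsMinor 𝒞 (deleteC e 𝒟)
  con  : ∀ {m} {𝒟 : SetOfSignVecs (suc m)} → IsMinor 𝒞 𝒟 →
         (e : Fin (suc m)) → IsMinor 𝒞 (contractC e 𝒟)

flipIf : Bool → Sign → Sign
flipIf true  s = neg s
flipIf false s = s

-- reorient on A (A i = true means i is flipped), then relabel by σ : Fin m ↔ Fin m
-- (element i is renamed σ i).
reorientRelabel : ∀ {m} → Subset m → (σ : Fin m ↔ Fin m) → SignVec m → SignVec m
reorientRelabel A σ X =
  tabulate (λ j → flipIf (lookup A (Inverse.from σ j)) (lookup X (Inverse.from σ j)))

Isomorphic : ∀ {m} → SetOfSignVecs m → SetOfSignVecs m → Set
Isomorphic {m} 𝒞 𝒟 =
  Σ (Subset m) λ A → Σ (Fin m ↔ Fin m) λ σ →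
    ∀ X → 𝒞 X ⇔ 𝒟 (reorientRelabel A σ X)

-- The alternating oriented matroid C^{6,4}, realised by the moment curve
-- vectors v_t = (1, t, t², t³), t = 1..6 (all maximal minors are positive
-- Vandermonde determinants).

momentVec : Fin 6 → Fin 4 → ℤ
momentVec i k = + ((suc (toℕ i)) ^ (toℕ k))

sumZ : ∀ {n} → Vec ℤ n → ℤ
sumZ = foldr _ ℤ._+_ (+ 0)

IsDependency : Vec ℤ 6 → Set
IsDependency λs = ∀ (k : Fin 4) →
  sumZ (tabulate (λ i → lookup λs i ℤ.* momentVec i k)) ≡ + 0

IsNonzeroZ : Vec ℤ 6 → Set
IsNonzeroZ λs = ∃ λ i → lookup λs i ≢ + 0

IsMinimalDependency : Vec ℤ 6 → Set
IsMinimalDependency λs =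
  IsDependency λs × IsNonzeroZ λs ×
  (∀ μ → IsDependency μ → IsNonzeroZ μ →
     (∀ i → lookup λs i ≡ + 0 → lookup μ i ≡ + 0) →
     (∀ i → lookup μ i ≡ + 0 → lookup λs i ≡ + 0))

signℤ : ℤ → Sign
signℤ (+ zero)  = 𝟘
signℤ (+ suc _) = ＋
signℤ -[1+ _ ]  = −

C64 : SetOfSignVecs 6
C64 X = ∃ λ λs → IsMinimalDependency λs × X ≡ map signℤ λs

-- Deletions keep a uniform oriented matroid of rank d uniform of rank d, and in corank 2 a
-- contraction makes it uniform of rank d - 1; so there is a uniform minor of rank 4 on six
-- elements.  There, for each element a the circuits vanishing at a are ±Y a for a single circuit
-- Y a supported off a.  Eliminating element 0 between multiples of Y (a + 1) and Y (b + 1)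
-- yields a multiple of Y 0, and comparing signs makes "a before b" a transitive tournament on
-- the other five elements.  Relabelling by its ranking and reorienting suitably turns every Y a
-- into a multiple of the alternating sign vector vanishing at a.  These are exactly the circuits
-- of C^{6,4}: on a dependency of the moment vectors vanishing at a, the signs alternate along the
-- other five vectors, because a cubic vanishing at three of them has equal signs at the two
-- remaining adjacent ones and turns the dependency into a relation between those two entries.
module Submission where

open import Defs
open import Data.Bool using (Bool; true; false; if_then_else_)
open import Data.Empty using (⊥-elim)
open import Data.Fin as Fin using (Fin; zero; suc; toℕ; fromℕ<; punchIn; punchOut; inject₁; #_)
open import Data.Fin.Properties
  using (all?; any?; suc-injective; toℕ-fromℕ<; punchIn-punchOut; punchOut-injective; injective⇒≤)
open import Data.Fin.Subset using (Subset; ∣_∣; _∈_; _∉_; _⊆_; inside; outside; ⊤) renaming (_-_ to _∖_)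
open import Data.Fin.Subset.Properties
  using (_∈?_; ∈⊤; ∣⊤∣≡n; ∣p∣≡n⇒p≡⊤; p⊆q⇒∣p∣≤∣q∣; p⊂q⇒∣p∣<∣q∣; x∈p∧x≢y⇒x∈p-y)
open import Data.Nat as ℕ using (ℕ; zero; suc; _≤_; _<_)
import Data.Nat.Properties as ℕ
open import Data.Product using (Σ; ∃; ∃₂; _×_; _,_; proj₁; proj₂)
open import Data.Sum as Sum using (_⊎_; inj₁; inj₂; [_,_]′)
open import Data.Vec using (Vec; []; _∷_; lookup; map; tabulate; insertAt)
open import Data.Vec.Properties
  using (lookup-map; map-cong; map-id; map-∘; tabulate-cong; tabulate∘lookup; lookup∘tabulate;
         []=⇒lookup; lookup⇒[]=; ∷-injectiveˡ; ∷-injectiveʳ; insertAt-lookup; insertAt-punchIn)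
open import Function using (_∘_; id)
open import Function.Bundles using (_↔_; _⇔_; mk⇔; mk↔ₛ′; Inverse; Equivalence)
open import Function.Definitions using (Injective)
open import Relation.Binary.PropositionalEquality
open import Relation.Nullary using (¬_; Dec; yes; no; does)
open import Relation.Nullary.Decidable using (_×-dec_; _⊎-dec_; ¬?; from-yes; dec-true; dec-false)

infixl 7 _·_
infix 4 _≟ˢ_

_·_ : Sign → Sign → Sign
x · ＋ = x
x · 𝟘 = 𝟘
x · − = neg x

_≟ˢ_ : (x y : Sign) → Dec (x ≡ y)
− ≟ˢ − = yes refl
𝟘 ≟ˢ 𝟘 = yes refl
＋ ≟ˢ ＋ = yes refl
− ≟ˢ 𝟘 = no λ ()
− ≟ˢ ＋ = no λ ()
𝟘 ≟ˢ − = no λ ()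
𝟘 ≟ˢ ＋ = no λ ()
＋ ≟ˢ − = no λ ()
＋ ≟ˢ 𝟘 = no λ ()

neg-involutive : ∀ x → neg (neg x) ≡ x
neg-involutive − = refl
neg-involutive 𝟘 = refl
neg-involutive ＋ = refl

negVec-involutive : ∀ {n} (V : SignVec n) → negVec (negVec V) ≡ V
negVec-involutive [] = refl
negVec-involutive (x ∷ V) = cong₂ _∷_ (neg-involutive x) (negVec-involutive V)

neg-nonzero : ∀ {x} → x ≢ 𝟘 → neg x ≢ 𝟘
neg-nonzero {x} x≢𝟘 e = x≢𝟘 (trans (sym (neg-involutive x)) (cong neg e))

·-identityˡ : ∀ x → ＋ · x ≡ x
·-identityˡ − = refl
·-identityˡ 𝟘 = refl
·-identityˡ ＋ = refl

·-zeroˡ : ∀ x → 𝟘 · x ≡ 𝟘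
·-zeroˡ − = refl
·-zeroˡ 𝟘 = refl
·-zeroˡ ＋ = refl

neg-·ʳ : ∀ x y → x · neg y ≡ neg (x · y)
neg-·ʳ x − = sym (neg-involutive x)
neg-·ʳ x 𝟘 = refl
neg-·ʳ x ＋ = refl

·-assoc : ∀ x y z → (x · y) · z ≡ x · (y · z)
·-assoc x y ＋ = refl
·-assoc x y 𝟘 = refl
·-assoc x y − = sym (neg-·ʳ x y)

·-comm : ∀ x y → x · y ≡ y · x
·-comm x ＋ = sym (·-identityˡ x)
·-comm x 𝟘 = sym (·-zeroˡ x)
·-comm − − = refl
·-comm 𝟘 − = refl
·-comm ＋ − = refl

neg-·ˡ : ∀ x y → neg x · y ≡ neg (x · y)
neg-·ˡ x y = trans (·-comm (neg x) y) (trans (neg-·ʳ y x) (cong neg (·-comm y x)))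

·-self : ∀ {x} → x ≢ 𝟘 → x · x ≡ ＋
·-self {−} _ = refl
·-self {𝟘} x≢𝟘 = ⊥-elim (x≢𝟘 refl)
·-self {＋} _ = refl

·-nonzero : ∀ {x y} → x ≢ 𝟘 → y ≢ 𝟘 → x · y ≢ 𝟘
·-nonzero {x} {−} x≢𝟘 _ = neg-nonzero x≢𝟘
·-nonzero {x} {𝟘} _ y≢𝟘 = ⊥-elim (y≢𝟘 refl)
·-nonzero {x} {＋} x≢𝟘 _ = x≢𝟘

·-cancelʳ : ∀ {x y} z → z ≢ 𝟘 → x · z ≡ y → x ≡ y · z
·-cancelʳ {x} {y} z z≢𝟘 refl = sym (begin
  (x · z) · z  ≡⟨ ·-assoc x z z ⟩
  x · (z · z)  ≡⟨ cong (x ·_) (·-self z≢𝟘) ⟩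
  x            ∎)
  where open ≡-Reasoning

lookup-extensional : ∀ {A : Set} {n} {xs ys : Vec A n} → (∀ i → lookup xs i ≡ lookup ys i) → xs ≡ ys
lookup-extensional {xs = xs} {ys} h =
  trans (sym (tabulate∘lookup xs)) (trans (tabulate-cong h) (tabulate∘lookup ys))

scale : ∀ {n} → Sign → SignVec n → SignVec n
scale s = map (s ·_)

lookup-scale : ∀ {n} s (V : SignVec n) i → lookup (scale s V) i ≡ s · lookup V i
lookup-scale s V i = lookup-map i (s ·_) V

scale-identity : ∀ {n} (V : SignVec n) → scale ＋ V ≡ V
scale-identity V = trans (map-cong ·-identityˡ V) (map-id V)

scale-neg : ∀ {n} (V : SignVec n) → scale − V ≡ negVec V
scale-neg V = map-cong (λ x → ·-comm − x) V

scale-scale : ∀ {n} s t (V : SignVec n) → scale s (scale t V) ≡ scale (s · t) V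
scale-scale s t V = trans (sym (map-∘ (s ·_) (t ·_) V)) (map-cong (λ x → sym (·-assoc s t x)) V)

isNonzero-true : ∀ {x} → x ≢ 𝟘 → isNonzero x ≡ true
isNonzero-true {−} _ = refl
isNonzero-true {𝟘} x≢𝟘 = ⊥-elim (x≢𝟘 refl)
isNonzero-true {＋} _ = refl

isNonzero-true⁻ : ∀ {x} → isNonzero x ≡ true → x ≢ 𝟘
isNonzero-true⁻ {−} _ ()
isNonzero-true⁻ {＋} _ ()

isNonzero-false⁻ : ∀ {x} → isNonzero x ≡ false → x ≡ 𝟘
isNonzero-false⁻ {𝟘} _ = refl

isNonzero-neg : ∀ x → isNonzero (neg x) ≡ isNonzero x
isNonzero-neg − = refl
isNonzero-neg 𝟘 = refl
isNonzero-neg ＋ = refl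

∈-supp : ∀ {n} {X : SignVec n} {i} → lookup X i ≢ 𝟘 → i ∈ supp X
∈-supp {X = X} {i} Xi≢𝟘 = lookup⇒[]= i (supp X) (trans (lookup-map i isNonzero X) (isNonzero-true Xi≢𝟘))

∈-supp⁻ : ∀ {n} {X : SignVec n} {i} → i ∈ supp X → lookup X i ≢ 𝟘
∈-supp⁻ {X = X} {i} i∈X = isNonzero-true⁻ (trans (sym (lookup-map i isNonzero X)) ([]=⇒lookup i∈X))

∉-supp⁻ : ∀ {n} {X : SignVec n} {i} → i ∉ supp X → lookup X i ≡ 𝟘
∉-supp⁻ {X = X} {i} i∉X with lookup X i ≟ˢ 𝟘
... | yes Xi≡𝟘 = Xi≡𝟘
... | no Xi≢𝟘 = ⊥-elim (i∉X (∈-supp {X = X} Xi≢𝟘))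

⊑⇒supp⊆ : ∀ {n} {X Y : SignVec n} → X ⊑ Y → supp X ⊆ supp Y
⊑⇒supp⊆ X⊑Y i∈X = ∈-supp (X⊑Y _ (∈-supp⁻ i∈X))

supp⊆⇒⊑ : ∀ {n} {X Y : SignVec n} → supp X ⊆ supp Y → X ⊑ Y
supp⊆⇒⊑ X⊆Y i Xi≢𝟘 = ∈-supp⁻ (X⊆Y (∈-supp Xi≢𝟘))

⊆-by-size : ∀ {n} {p q : Subset n} → p ⊆ q → ∣ q ∣ ≤ ∣ p ∣ → q ⊆ p
⊆-by-size {p = p} {q} p⊆q ∣q∣≤∣p∣ {x} x∈q with x ∈? p
... | yes x∈p = x∈p
... | no x∉p = ⊥-elim (ℕ.<⇒≱ (p⊂q⇒∣p∣<∣q∣ (p⊆q , x , x∈q , x∉p)) ∣q∣≤∣p∣)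

⊑-by-size : ∀ {n} {X Y : SignVec n} → X ⊑ Y → ∣ supp Y ∣ ≤ ∣ supp X ∣ → Y ⊑ X
⊑-by-size {X = X} {Y} X⊑Y ∣Y∣≤∣X∣ = supp⊆⇒⊑ {X = Y} {X} (⊆-by-size (⊑⇒supp⊆ {X = X} {Y} X⊑Y) ∣Y∣≤∣X∣)

full-support : ∀ {n} {X : SignVec n} → ∣ supp X ∣ ≡ n → ∀ i → lookup X i ≢ 𝟘
full-support {X = X} ∣X∣≡n i = ∈-supp⁻ {X = X} (subst (i ∈_) (sym (∣p∣≡n⇒p≡⊤ ∣X∣≡n)) ∈⊤)

nonzero-if-supported : ∀ {n k} {X : SignVec n} → ∣ supp X ∣ ≡ suc k → X ≢ zeroVec
nonzero-if-supported {suc n} ∣X∣≡1+k refl = nonzero-if-supported {n} ∣X∣≡1+k refl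

∣x∷p∣≤1+∣p∣ : ∀ {n} x (p : Subset n) → ∣ x ∷ p ∣ ≤ suc ∣ p ∣
∣x∷p∣≤1+∣p∣ true p = ℕ.≤-refl
∣x∷p∣≤1+∣p∣ false p = ℕ.n≤1+n ∣ p ∣

∣p∣<n : ∀ {n} {p : Subset n} {x} → x ∉ p → ∣ p ∣ < n
∣p∣<n {n} {p} x∉p = subst (∣ p ∣ <_) (∣⊤∣≡n n) (p⊂q⇒∣p∣<∣q∣ ((λ _ → ∈⊤) , _ , ∈⊤ , x∉p))

-- Uniform oriented matroids and their minors

scale-circuit : ∀ {n} {𝒞 : SetOfSignVecs n} → IsOrientedMatroid 𝒞 → ∀ {s X} → s ≢ 𝟘 → 𝒞 X → 𝒞 (scale s X)
scale-circuit {𝒞 = 𝒞} _ {＋} {X} _ 𝒞X = subst 𝒞 (sym (scale-identity X)) 𝒞X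
scale-circuit {𝒞 = 𝒞} isOM {−} {X} _ 𝒞X = subst 𝒞 (sym (scale-neg X)) (IsOrientedMatroid.C1 isOM X 𝒞X)
scale-circuit _ {𝟘} 𝟘≢𝟘 _ = ⊥-elim (𝟘≢𝟘 refl)

conformal-entry : ∀ {n} {X Y Z : SignVec n} →
  (∀ i → lookup Z i ≡ ＋ → (lookup X i ≡ ＋) ⊎ (lookup Y i ≡ ＋)) →
  (∀ i → lookup Z i ≡ − → (lookup X i ≡ −) ⊎ (lookup Y i ≡ −)) →
  ∀ i → lookup Z i ≢ 𝟘 → (lookup Z i ≡ lookup X i) ⊎ (lookup Z i ≡ lookup Y i)
conformal-entry {Z = Z} pos negative i Zi≢𝟘 with lookup Z i in Zi
... | ＋ = Sum.map sym sym (pos i Zi)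
... | − = Sum.map sym sym (negative i Zi)
... | 𝟘 = ⊥-elim (Zi≢𝟘 refl)

conformal-to-zeros : ∀ {z} → (z ≡ ＋ → 𝟘 ≡ ＋ ⊎ 𝟘 ≡ ＋) → (z ≡ − → 𝟘 ≡ − ⊎ 𝟘 ≡ −) → z ≡ 𝟘
conformal-to-zeros {−} _ negative with negative refl
... | inj₁ ()
... | inj₂ ()
conformal-to-zeros {𝟘} _ _ = refl
conformal-to-zeros {＋} pos _ with pos refl
... | inj₁ ()
... | inj₂ ()

IsUniform : ∀ {n} → ℕ → SetOfSignVecs n → Set
IsUniform {n} d 𝒞 = ∀ (S : Subset n) → (∣ S ∣ ≡ suc d) ⇔ (∃ λ X → 𝒞 X × supp X ≡ S)

record IsUniformOM {n} (d : ℕ) (𝒞 : SetOfSignVecs n) : Set where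
  field
    isOrientedMatroid : IsOrientedMatroid 𝒞
    isUniform         : IsUniform d 𝒞

  open IsOrientedMatroid isOrientedMatroid public

  circuit-size : ∀ {X} → 𝒞 X → ∣ supp X ∣ ≡ suc d
  circuit-size {X} c = Equivalence.from (isUniform (supp X)) (X , c , refl)

  circuit-on : ∀ S → ∣ S ∣ ≡ suc d → ∃ λ X → 𝒞 X × supp X ≡ S
  circuit-on S = Equivalence.to (isUniform S)

-- Both 𝒞 ∖ 0 (b = false) and, in corank 2, 𝒞 / 0 (b = true) are the family of tails of those
-- circuits of 𝒞 whose head has support b; the hypothesis head says that eliminating away from 0
-- stays inside that family.
module Tails {m d d′ : ℕ} (b : Bool) {𝒞 : SetOfSignVecs (suc m)} {𝒟 : SetOfSignVecs m}
  (U : IsUniformOM d 𝒞)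
  (lift : ∀ {X : SignVec m} → 𝒟 X → ∃ λ (s : Sign) → isNonzero s ≡ b × 𝒞 (s ∷ X))
  (lower : ∀ {s : Sign} {X : SignVec m} → isNonzero s ≡ b → 𝒞 (s ∷ X) → 𝒟 X)
  (no-zero : ¬ 𝒟 zeroVec)
  (head : ∀ {s t z : Sign} {Z : SignVec m} (e : Fin m) →
          isNonzero s ≡ b → isNonzero t ≡ b → 𝒞 (z ∷ Z) → lookup Z e ≡ 𝟘 →
          (z ≡ ＋ → s ≡ ＋ ⊎ t ≡ ＋) → (z ≡ − → s ≡ − ⊎ t ≡ −) → isNonzero z ≡ b)
  (size : ∀ (S : Subset m) → ∣ b ∷ S ∣ ≡ suc d ⇔ ∣ S ∣ ≡ suc d′)
  where
  open IsUniformOM U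

  private
    head-⊑ : ∀ {s t} → isNonzero s ≡ b → isNonzero t ≡ b → s ≢ 𝟘 → t ≢ 𝟘
    head-⊑ s≡b t≡b s≢𝟘 = isNonzero-true⁻ (trans t≡b (trans (sym s≡b) (isNonzero-true s≢𝟘)))

    ⊑-cons : ∀ {s t} {X Y : SignVec m} → (s ≢ 𝟘 → t ≢ 𝟘) → X ⊑ Y → (s ∷ X) ⊑ (t ∷ Y)
    ⊑-cons h X⊑Y zero = h
    ⊑-cons h X⊑Y (suc i) = X⊑Y i

    elimination : ∀ X Y e → 𝒟 X → 𝒟 Y → X ≢ negVec Y → lookup X e ≡ ＋ → lookup Y e ≡ − →
                  ∃ λ Z → 𝒟 Z × lookup Z e ≡ 𝟘 ×
                    (∀ i → lookup Z i ≡ ＋ → (lookup X i ≡ ＋) ⊎ (lookup Y i ≡ ＋)) ×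
                    (∀ i → lookup Z i ≡ − → (lookup X i ≡ −) ⊎ (lookup Y i ≡ −))
    elimination X Y e 𝒟X 𝒟Y X≢-Y Xe Ye
      with s , s≡b , 𝒞sX ← lift 𝒟X | t , t≡b , 𝒞tY ← lift 𝒟Y
      with z ∷ Z , 𝒞zZ , Ze , pos , negative
             ← C3 (s ∷ X) (t ∷ Y) (suc e) 𝒞sX 𝒞tY (X≢-Y ∘ ∷-injectiveʳ) Xe Ye
      = Z , lower (head e s≡b t≡b 𝒞zZ Ze (pos zero) (negative zero)) 𝒞zZ ,
        Ze , pos ∘ suc , negative ∘ suc

    tails-isOrientedMatroid : IsOrientedMatroid 𝒟
    tails-isOrientedMatroid = record
      { C0 = no-zero
      ; C1 = λ X 𝒟X → let s , s≡b , 𝒞sX = lift 𝒟X in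
               lower (trans (isNonzero-neg s) s≡b) (C1 (s ∷ X) 𝒞sX)
      ; C2 = λ X Y 𝒟X 𝒟Y X⊑Y →
               let s , s≡b , 𝒞sX = lift 𝒟X ; t , t≡b , 𝒞tY = lift 𝒟Y in
               Sum.map ∷-injectiveʳ ∷-injectiveʳ
                 (C2 (s ∷ X) (t ∷ Y) 𝒞sX 𝒞tY (⊑-cons (head-⊑ s≡b t≡b) X⊑Y))
      ; C3 = elimination
      }

    tails-isUniform : IsUniform d′ 𝒟
    tails-isUniform S = mk⇔ to from
      where
      to : ∣ S ∣ ≡ suc d′ → ∃ λ X → 𝒟 X × supp X ≡ S
      to ∣S∣ with s ∷ X , 𝒞sX , eq ← circuit-on (b ∷ S) (Equivalence.from (size S) ∣S∣)
        = X , lower (∷-injectiveˡ eq) 𝒞sX , ∷-injectiveʳ eq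
      from : (∃ λ X → 𝒟 X × supp X ≡ S) → ∣ S ∣ ≡ suc d′
      from (X , 𝒟X , refl) with s , s≡b , 𝒞sX ← lift 𝒟X
        = Equivalence.to (size S) (subst (λ h → ∣ h ∷ S ∣ ≡ suc d) s≡b (circuit-size 𝒞sX))

  isUniformOM : IsUniformOM d′ 𝒟
  isUniformOM = record { isOrientedMatroid = tails-isOrientedMatroid ; isUniform = tails-isUniform }

delete-isUniformOM : ∀ {m d} {𝒞 : SetOfSignVecs (suc m)} → IsUniformOM d 𝒞 → IsUniformOM d (deleteC zero 𝒞)
delete-isUniformOM {𝒞 = 𝒞} U =
  Tails.isUniformOM false U (λ 𝒞0X → 𝟘 , refl , 𝒞0X) lower C0 head (λ _ → mk⇔ id id)
  where
  open IsUniformOM U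
  lower : ∀ {s X} → isNonzero s ≡ false → 𝒞 (s ∷ X) → 𝒞 (𝟘 ∷ X)
  lower s≡false 𝒞sX with refl ← isNonzero-false⁻ s≡false = 𝒞sX
  head : ∀ {s t z} {Z : SignVec _} e → isNonzero s ≡ false → isNonzero t ≡ false →
         𝒞 (z ∷ Z) → lookup Z e ≡ 𝟘 →
         (z ≡ ＋ → s ≡ ＋ ⊎ t ≡ ＋) → (z ≡ − → s ≡ − ⊎ t ≡ −) → isNonzero z ≡ false
  head _ s≡false t≡false _ _ pos negative
    with refl ← isNonzero-false⁻ s≡false | refl ← isNonzero-false⁻ t≡false
    = cong isNonzero (conformal-to-zeros pos negative)

contract-isUniformOM : ∀ {d} {𝒞 : SetOfSignVecs (suc (suc (suc d)))} → IsUniformOM (suc d) 𝒞 →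
                       IsUniformOM d (contractC zero 𝒞)
contract-isUniformOM {d} {𝒞} U =
  Tails.isUniformOM true U lift lower (λ c → proj₁ (proj₂ c) refl) head
    (λ _ → mk⇔ ℕ.suc-injective (cong suc))
  where
  open IsUniformOM U

  tail-size : ∀ {s X} → isNonzero s ≡ true → 𝒞 (s ∷ X) → ∣ supp X ∣ ≡ suc d
  tail-size {X = X} s≡true 𝒞sX =
    ℕ.suc-injective (subst (λ h → ∣ h ∷ supp X ∣ ≡ suc (suc d)) s≡true (circuit-size 𝒞sX))

  lower : ∀ {s X} → isNonzero s ≡ true → 𝒞 (s ∷ X) → contractC zero 𝒞 X
  lower {s} {X} s≡true 𝒞sX = (s , 𝒞sX) , nonzero-if-supported (tail-size s≡true 𝒞sX) , minimal
    where
    minimal : ∀ Y → restrictsFrom zero 𝒞 Y → Y ≢ zeroVec → Y ⊑ X → X ⊑ Y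
    minimal Y (t , 𝒞tY) _ Y⊑X = ⊑-by-size {X = Y} {X} Y⊑X
      (ℕ.≤-trans (ℕ.≤-reflexive (tail-size s≡true 𝒞sX))
                 (ℕ.s≤s⁻¹ (subst (_≤ suc ∣ supp Y ∣) (circuit-size 𝒞tY) (∣x∷p∣≤1+∣p∣ (isNonzero t) (supp Y)))))

  -- A circuit with zero head has full tail support; the circuit supported off element 1 would then
  -- restrict to a strictly smaller nonzero vector.
  lift : ∀ {X} → contractC zero 𝒞 X → ∃ λ s → isNonzero s ≡ true × 𝒞 (s ∷ X)
  lift {X} ((s , 𝒞sX) , _ , minimal) with s
  ... | − = − , refl , 𝒞sX
  ... | ＋ = ＋ , refl , 𝒞sX
  ... | 𝟘 with w ∷ v ∷ Y , 𝒞W , eq ← circuit-on (inside ∷ outside ∷ ⊤) (cong suc (∣⊤∣≡n (suc d)))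
    with refl ← isNonzero-false⁻ (∷-injectiveˡ (∷-injectiveʳ eq))
    = ⊥-elim (minimal (𝟘 ∷ Y) (w , 𝒞W) (nonzero-if-supported ∣Y∣) (λ i _ → X-full i)
                      zero (X-full zero) refl)
    where
    X-full = full-support {X = X} (circuit-size 𝒞sX)
    ∣Y∣ : ∣ supp Y ∣ ≡ suc d
    ∣Y∣ = trans (cong ∣_∣ (∷-injectiveʳ (∷-injectiveʳ eq))) (∣⊤∣≡n (suc d))

  head : ∀ {s t z} {Z : SignVec _} e → isNonzero s ≡ true → isNonzero t ≡ true →
         𝒞 (z ∷ Z) → lookup Z e ≡ 𝟘 →
         (z ≡ ＋ → s ≡ ＋ ⊎ t ≡ ＋) → (z ≡ − → s ≡ − ⊎ t ≡ −) → isNonzero z ≡ true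
  head {z = −} _ _ _ _ _ _ _ = refl
  head {z = ＋} _ _ _ _ _ _ _ = refl
  head {z = 𝟘} {Z} e _ _ 𝒞zZ Ze _ _ = ⊥-elim (full-support {X = Z} (circuit-size 𝒞zZ) e Ze)

IsMinor-trans : ∀ {n m k} {𝒞 : SetOfSignVecs n} {𝒟 : SetOfSignVecs m} {ℰ : SetOfSignVecs k} →
                IsMinor 𝒞 𝒟 → IsMinor 𝒟 ℰ → IsMinor 𝒞 ℰ
IsMinor-trans 𝒞≻𝒟 self = 𝒞≻𝒟
IsMinor-trans 𝒞≻𝒟 (del 𝒟≻ℰ e) = del (IsMinor-trans 𝒞≻𝒟 𝒟≻ℰ) e
IsMinor-trans 𝒞≻𝒟 (con 𝒟≻ℰ e) = con (IsMinor-trans 𝒞≻𝒟 𝒟≻ℰ) e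

UniformMinor : ∀ {n} → SetOfSignVecs n → (m d : ℕ) → Set₁
UniformMinor 𝒞 m d = Σ (SetOfSignVecs m) λ 𝒟 → IsMinor 𝒞 𝒟 × IsUniformOM d 𝒟

corank2-minor : ∀ {n d} {𝒞 : SetOfSignVecs n} → suc (suc d) ≤ n → IsUniformOM d 𝒞 →
                UniformMinor 𝒞 (suc (suc d)) d
corank2-minor {suc n} 2+d≤1+n U with ℕ.m≤n⇒m<n∨m≡n 2+d≤1+n
... | inj₂ refl = _ , self , U
... | inj₁ (ℕ.s≤s 2+d≤n) =
  let 𝒟 , 𝒞∖0≻𝒟 , U𝒟 = corank2-minor 2+d≤n (delete-isUniformOM U) in
  𝒟 , IsMinor-trans (del self zero) 𝒞∖0≻𝒟 , U𝒟

rank4-minor : ∀ {d} {𝒞 : SetOfSignVecs (suc (suc d))} → 4 ≤ d → IsUniformOM d 𝒞 → UniformMinor 𝒞 6 4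
rank4-minor {1} (ℕ.s≤s ())
rank4-minor {2} (ℕ.s≤s (ℕ.s≤s ()))
rank4-minor {3} (ℕ.s≤s (ℕ.s≤s (ℕ.s≤s ())))
rank4-minor {4} _ U = _ , self , U
rank4-minor {suc (suc (suc (suc (suc d))))} _ U =
  let 𝒟 , 𝒞/0≻𝒟 , U𝒟 = rank4-minor (ℕ.s≤s (ℕ.s≤s (ℕ.s≤s (ℕ.s≤s ℕ.z≤n)))) (contract-isUniformOM U) in
  𝒟 , IsMinor-trans (con self zero) 𝒞/0≻𝒟 , U𝒟

-- The alternating oriented matroid C^{6,4}

module Alternating where
  open import Data.Integer as ℤ using (ℤ; +_; -[1+_]; _+_; _*_; _-_; -_)
  import Data.Integer.Properties as ℤ
  open import Data.Integer.Tactic.RingSolver using (solve-∀)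

  signs : ∀ {n} → Vec ℤ n → SignVec n
  signs = map signℤ

  signℤ-* : ∀ x y → signℤ (x * y) ≡ signℤ x · signℤ y
  signℤ-* (+ zero) y = sym (·-zeroˡ (signℤ y))
  signℤ-* (+ suc m) (+ zero) rewrite ℕ.*-zeroʳ m = refl
  signℤ-* (+ suc m) (+ suc n) = refl
  signℤ-* (+ suc m) -[1+ n ] = refl
  signℤ-* -[1+ m ] (+ zero) rewrite ℕ.*-zeroʳ m = refl
  signℤ-* -[1+ m ] (+ suc n) = refl
  signℤ-* -[1+ m ] -[1+ n ] = refl

  signℤ-+ : ∀ u v → u + v ≡ + 0 → signℤ u ≡ neg (signℤ v)
  signℤ-+ (+ zero) (+ zero) _ = refl
  signℤ-+ (+ suc m) -[1+ n ] _ = refl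
  signℤ-+ -[1+ m ] (+ suc n) _ = refl

  signℤ-neg : ∀ x → signℤ (- x) ≡ neg (signℤ x)
  signℤ-neg (+ zero) = refl
  signℤ-neg (+ suc n) = refl
  signℤ-neg -[1+ n ] = refl

  signℤ-zero⁻ : ∀ {x} → signℤ x ≡ 𝟘 → x ≡ + 0
  signℤ-zero⁻ {+ zero} _ = refl

  opposite-signs : ∀ u v p q → u * p + v * q ≡ + 0 → signℤ p · signℤ q ≡ ＋ → signℤ v ≡ neg (signℤ u)
  opposite-signs u v p q up+vq≡0 sp·sq≡＋ = trans (sym (neg-involutive (signℤ v))) (cong neg (sym su≡-sv))
    where
    open ≡-Reasoning
    su = signℤ u ; sv = signℤ v ; sp = signℤ p ; sq = signℤ q
    sq≢𝟘 : sq ≢ 𝟘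
    sq≢𝟘 sq≡𝟘 with () ← trans (sym sp·sq≡＋) (cong (sp ·_) sq≡𝟘)
    su·sp≡-sv·sq : su · sp ≡ neg (sv · sq)
    su·sp≡-sv·sq = trans (sym (signℤ-* u p)) (trans (signℤ-+ _ _ up+vq≡0) (cong neg (signℤ-* v q)))
    su≡-sv : su ≡ neg sv
    su≡-sv = begin
      su                   ≡⟨ cong (su ·_) (sym sp·sq≡＋) ⟩
      su · (sp · sq)       ≡⟨ sym (·-assoc su sp sq) ⟩
      (su · sp) · sq       ≡⟨ cong (_· sq) su·sp≡-sv·sq ⟩
      neg (sv · sq) · sq   ≡⟨ neg-·ˡ (sv · sq) sq ⟩
      neg ((sv · sq) · sq) ≡⟨ cong neg (trans (·-assoc sv sq sq) (cong (sv ·_) (·-self sq≢𝟘))) ⟩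
      neg sv               ∎

  sum-zero : ∀ {n} (f : Fin n → ℤ) → (∀ k → f k ≡ + 0) → sumZ (tabulate f) ≡ + 0
  sum-zero {zero} f _ = refl
  sum-zero {suc n} f f≡0 = cong₂ _+_ (f≡0 zero) (sum-zero (f ∘ suc) (f≡0 ∘ suc))

  sum-single : ∀ {n} (f : Fin n → ℤ) {i} → (∀ k → k ≢ i → f k ≡ + 0) → sumZ (tabulate f) ≡ f i
  sum-single {suc n} f {zero} vanishes =
    trans (cong (λ s → f zero + s) (sum-zero (f ∘ suc) (λ k → vanishes (suc k) λ ())))
          (ℤ.+-identityʳ (f zero))
  sum-single {suc n} f {suc i} vanishes =
    trans (cong₂ _+_ (vanishes zero λ ())
                     (sum-single (f ∘ suc) (λ k k≢i → vanishes (suc k) (k≢i ∘ suc-injective))))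
          (ℤ.+-identityˡ (f (suc i)))

  sum-pair : ∀ {n} (f : Fin n → ℤ) {i j} → i ≢ j → (∀ k → k ≢ i → k ≢ j → f k ≡ + 0) →
             sumZ (tabulate f) ≡ f i + f j
  sum-pair f {zero} {zero} i≢j _ = ⊥-elim (i≢j refl)
  sum-pair f {zero} {suc j} _ vanishes =
    cong (λ s → f zero + s) (sum-single (f ∘ suc) (λ k k≢j → vanishes (suc k) (λ ()) (k≢j ∘ suc-injective)))
  sum-pair f {suc i} {zero} _ vanishes =
    trans (cong (λ s → f zero + s)
                (sum-single (f ∘ suc) (λ k k≢i → vanishes (suc k) (k≢i ∘ suc-injective) (λ ()))))
          (ℤ.+-comm (f zero) (f (suc i)))
  sum-pair f {suc i} {suc j} i≢j vanishes =
    trans (cong₂ _+_ (vanishes zero (λ ()) (λ ()))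
            (sum-pair (f ∘ suc) (i≢j ∘ cong suc)
                      (λ k k≢i k≢j → vanishes (suc k) (k≢i ∘ suc-injective) (k≢j ∘ suc-injective))))
          (ℤ.+-identityˡ _)

  -- t i = i + 1 is the parameter of the i-th moment vector (1, t, t², t³)
  t : Fin 6 → ℤ
  t i = + suc (Fin.toℕ i)

  cubic : Vec (Fin 6) 3 → Fin 6 → ℤ
  cubic (r₁ ∷ r₂ ∷ r₃ ∷ []) i = (t i - t r₁) * (t i - t r₂) * (t i - t r₃)

  private
    -- Both sides are in the normal forms that sumZ and momentVec compute to: the left side is
    -- Σ mᵢ (tᵢ - x)(tᵢ - y)(tᵢ - z), the right side combines the moment sums Σ mᵢ tᵢᵏ.
    expand-cubic : ∀ m₀ m₁ m₂ m₃ m₄ m₅ x y z →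
      m₀ * ((+ 1 - x) * (+ 1 - y) * (+ 1 - z)) + (m₁ * ((+ 2 - x) * (+ 2 - y) * (+ 2 - z)) +
      (m₂ * ((+ 3 - x) * (+ 3 - y) * (+ 3 - z)) + (m₃ * ((+ 4 - x) * (+ 4 - y) * (+ 4 - z)) +
      (m₄ * ((+ 5 - x) * (+ 5 - y) * (+ 5 - z)) + (m₅ * ((+ 6 - x) * (+ 6 - y) * (+ 6 - z)) + + 0)))))
      ≡ (m₀ * + 1 + (m₁ * + 8 + (m₂ * + 27 + (m₃ * + 64 + (m₄ * + 125 + (m₅ * + 216 + + 0))))))
        - (x + y + z) * (m₀ * + 1 + (m₁ * + 4 + (m₂ * + 9 + (m₃ * + 16 + (m₄ * + 25 + (m₅ * + 36 + + 0))))))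
        + (x * y + y * z + z * x) * (m₀ * + 1 + (m₁ * + 2 + (m₂ * + 3 + (m₃ * + 4 + (m₄ * + 5 + (m₅ * + 6 + + 0))))))
        - x * y * z * (m₀ * + 1 + (m₁ * + 1 + (m₂ * + 1 + (m₃ * + 1 + (m₄ * + 1 + (m₅ * + 1 + + 0))))))
    expand-cubic = solve-∀

    combination-of-zeros : ∀ a b c {d₀ d₁ d₂ d₃} → d₀ ≡ + 0 → d₁ ≡ + 0 → d₂ ≡ + 0 → d₃ ≡ + 0 →
                           d₃ - a * d₂ + b * d₁ - c * d₀ ≡ + 0
    combination-of-zeros a b c refl refl refl refl rewrite ℤ.*-zeroʳ a | ℤ.*-zeroʳ b | ℤ.*-zeroʳ c = refl

  dependency-annihilates-cubic : ∀ μ → IsDependency μ → ∀ rs →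
                                 sumZ (tabulate (λ i → lookup μ i * cubic rs i)) ≡ + 0
  dependency-annihilates-cubic (m₀ ∷ m₁ ∷ m₂ ∷ m₃ ∷ m₄ ∷ m₅ ∷ []) D (r₁ ∷ r₂ ∷ r₃ ∷ []) =
    trans (expand-cubic m₀ m₁ m₂ m₃ m₄ m₅ x y z)
          (combination-of-zeros (x + y + z) (x * y + y * z + z * x) (x * y * z)
                                (D (# 0)) (D (# 1)) (D (# 2)) (D (# 3)))
    where x = t r₁ ; y = t r₂ ; z = t r₃

  -- left a k and right a k are the k-th and (k+1)-th positions other than a, and separator a k is the
  -- cubic vanishing at the remaining three.  Against a dependency vanishing at a it leaves just two
  -- terms, and as no root lies between left a k and right a k its values there have equal signs.
  left right : Fin 6 → Fin 4 → Fin 6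
  left a k = punchIn a (inject₁ k)
  right a k = punchIn a (suc k)

  complement : Fin 4 → Vec (Fin 5) 3
  complement zero = # 2 ∷ # 3 ∷ # 4 ∷ []
  complement (suc zero) = # 0 ∷ # 3 ∷ # 4 ∷ []
  complement (suc (suc zero)) = # 0 ∷ # 1 ∷ # 4 ∷ []
  complement (suc (suc (suc zero))) = # 0 ∷ # 1 ∷ # 2 ∷ []

  separator : Fin 6 → Fin 4 → Fin 6 → ℤ
  separator a k = cubic (map (punchIn a) (complement k))

  Separates : Fin 6 → Fin 4 → Set
  Separates a k =
    left a k ≢ right a k ×
    (∀ l → l ≡ a ⊎ l ≡ left a k ⊎ l ≡ right a k ⊎ separator a k l ≡ + 0) ×
    signℤ (separator a k (left a k)) · signℤ (separator a k (right a k)) ≡ ＋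

  -- Decided by evaluation; opaque so that later type checking never re-runs the decision.
  opaque
    separation : ∀ a k → Separates a k
    separation = from-yes (all? λ a → all? λ k → separates? a k)
      where
      separates? : ∀ a k → Dec (Separates a k)
      separates? a k =
        ¬? (left a k Fin.≟ right a k) ×-dec
        all? (λ l → l Fin.≟ a ⊎-dec l Fin.≟ left a k ⊎-dec l Fin.≟ right a k ⊎-dec
                    separator a k l ℤ.≟ + 0) ×-dec
        (signℤ (separator a k (left a k)) · signℤ (separator a k (right a k)) ≟ˢ ＋)

  adjacent-signs : ∀ μ {a} → IsDependency μ → lookup μ a ≡ + 0 → ∀ k →
                   signℤ (lookup μ (right a k)) ≡ neg (signℤ (lookup μ (left a k)))
  adjacent-signs μ {a} D μa≡0 k with l≢r , vanish , same ← separation a k =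
    opposite-signs _ _ _ _ (trans (sym (sum-pair term l≢r elsewhere)) (dependency-annihilates-cubic μ D roots)) same
    where
    roots = map (punchIn a) (complement k)
    term : Fin 6 → ℤ
    term l = lookup μ l * separator a k l
    elsewhere : ∀ l → l ≢ left a k → l ≢ right a k → term l ≡ + 0
    elsewhere l l≢left l≢right with vanish l
    ... | inj₁ refl = cong (_* separator a k l) μa≡0
    ... | inj₂ (inj₁ l≡left) = ⊥-elim (l≢left l≡left)
    ... | inj₂ (inj₂ (inj₁ l≡right)) = ⊥-elim (l≢right l≡right)
    ... | inj₂ (inj₂ (inj₂ separator≡0)) = trans (cong (lookup μ l *_) separator≡0) (ℤ.*-zeroʳ (lookup μ l))

  parity : ∀ {n} → Fin n → Sign
  parity zero = ＋
  parity (suc l) = neg (parity l)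

  parity-nonzero : ∀ {n} (l : Fin n) → parity l ≢ 𝟘
  parity-nonzero zero ()
  parity-nonzero (suc l) = neg-nonzero (parity-nonzero l)

  alternating : ∀ {n} (s : Fin (suc n) → Sign) → (∀ k → s (suc k) ≡ neg (s (inject₁ k))) →
                ∀ l → s l ≡ s zero · parity l
  alternating s _ zero = refl
  alternating {suc n} s flips (suc l) = begin
    s (suc l)                        ≡⟨ alternating (s ∘ suc) (flips ∘ suc) l ⟩
    s (suc zero) · parity l          ≡⟨ cong (_· parity l) (flips zero) ⟩
    neg (s zero) · parity l          ≡⟨ neg-·ˡ (s zero) (parity l) ⟩
    neg (s zero · parity l)          ≡⟨ sym (neg-·ʳ (s zero) (parity l)) ⟩
    s zero · neg (parity l)          ∎
    where open ≡-Reasoning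

  alternatingCircuit : Fin 6 → SignVec 6
  alternatingCircuit a = insertAt (tabulate parity) a 𝟘

  alternatingCircuit-punchIn : ∀ a l → lookup (alternatingCircuit a) (punchIn a l) ≡ parity l
  alternatingCircuit-punchIn a l = trans (insertAt-punchIn (tabulate parity) a 𝟘 l) (lookup∘tabulate parity l)

  dependency-signs : ∀ μ {a} → IsDependency μ → lookup μ a ≡ + 0 →
                     signs μ ≡ scale (signℤ (lookup μ (punchIn a zero))) (alternatingCircuit a)
  dependency-signs μ {a} D μa≡0 = lookup-extensional pointwise
    where
    s = signℤ (lookup μ (punchIn a zero))
    A = alternatingCircuit a
    pointwise : ∀ i → lookup (signs μ) i ≡ lookup (scale s A) i
    pointwise i with i Fin.≟ a
    ... | yes refl = begin
      lookup (signs μ) a      ≡⟨ lookup-map a signℤ μ ⟩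
      signℤ (lookup μ a)      ≡⟨ cong signℤ μa≡0 ⟩
      𝟘                       ≡⟨ cong (s ·_) (sym (insertAt-lookup (tabulate parity) a 𝟘)) ⟩
      s · lookup A a          ≡⟨ sym (lookup-scale s A a) ⟩
      lookup (scale s A) a    ∎
      where open ≡-Reasoning
    ... | no i≢a = begin
      lookup (signs μ) i                ≡⟨ lookup-map i signℤ μ ⟩
      signℤ (lookup μ i)                ≡⟨ cong (signℤ ∘ lookup μ) (sym a↑j≡i) ⟩
      signℤ (lookup μ (punchIn a j))    ≡⟨ alternating (signℤ ∘ lookup μ ∘ punchIn a) alternates j ⟩
      s · parity j                      ≡⟨ cong (s ·_) (sym (alternatingCircuit-punchIn a j)) ⟩
      s · lookup A (punchIn a j)        ≡⟨ cong (λ k → s · lookup A k) a↑j≡i ⟩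
      s · lookup A i                    ≡⟨ sym (lookup-scale s A i) ⟩
      lookup (scale s A) i              ∎
      where
      open ≡-Reasoning
      alternates = adjacent-signs μ D μa≡0
      j = punchOut (i≢a ∘ sym)
      a↑j≡i : punchIn a j ≡ i
      a↑j≡i = punchIn-punchOut (i≢a ∘ sym)

  leading-sign-nonzero : ∀ μ {a} → IsDependency μ → IsNonzeroZ μ → lookup μ a ≡ + 0 →
                         signℤ (lookup μ (punchIn a zero)) ≢ 𝟘
  leading-sign-nonzero μ {a} D (j , μj≢0) μa≡0 s≡𝟘 = μj≢0 (signℤ-zero⁻ (begin
    signℤ (lookup μ j)    ≡⟨ sym (lookup-map j signℤ μ) ⟩
    lookup (signs μ) j    ≡⟨ cong (λ V → lookup V j) (dependency-signs μ D μa≡0) ⟩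
    lookup (scale s A) j  ≡⟨ lookup-scale s A j ⟩
    s · lookup A j        ≡⟨ cong (_· lookup A j) s≡𝟘 ⟩
    𝟘 · lookup A j        ≡⟨ ·-zeroˡ (lookup A j) ⟩
    𝟘                     ∎))
    where
    open ≡-Reasoning
    s = signℤ (lookup μ (punchIn a zero))
    A = alternatingCircuit a

  alternatingCircuit-nonzero : ∀ {a i} → i ≢ a → lookup (alternatingCircuit a) i ≢ 𝟘
  alternatingCircuit-nonzero {a} {i} i≢a =
    subst (λ k → lookup (alternatingCircuit a) k ≢ 𝟘) (punchIn-punchOut (i≢a ∘ sym))
      (subst (_≢ 𝟘) (sym (alternatingCircuit-punchIn a j)) (parity-nonzero j))
    where j = punchOut (i≢a ∘ sym)

  dependency-zero-unique : ∀ μ {a i} → IsDependency μ → IsNonzeroZ μ →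
                           lookup μ a ≡ + 0 → lookup μ i ≡ + 0 → i ≡ a
  dependency-zero-unique μ {a} {i} D nz μa≡0 μi≡0 with i Fin.≟ a
  ... | yes i≡a = i≡a
  ... | no i≢a = ⊥-elim (·-nonzero (leading-sign-nonzero μ D nz μa≡0) (alternatingCircuit-nonzero i≢a) (begin
    s · lookup A i          ≡⟨ sym (lookup-scale s A i) ⟩
    lookup (scale s A) i    ≡⟨ cong (λ V → lookup V i) (sym (dependency-signs μ D μa≡0)) ⟩
    lookup (signs μ) i      ≡⟨ lookup-map i signℤ μ ⟩
    signℤ (lookup μ i)      ≡⟨ cong signℤ μi≡0 ⟩
    𝟘                       ∎))
    where
    open ≡-Reasoning
    s = signℤ (lookup μ (punchIn a zero))
    A = alternatingCircuit a

  minimal-if-vanishing : ∀ μ {a} → IsDependency μ → IsNonzeroZ μ → lookup μ a ≡ + 0 → IsMinimalDependency μ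
  minimal-if-vanishing μ {a} D nz μa≡0 = D , nz , minimal
    where
    minimal : ∀ ν → IsDependency ν → IsNonzeroZ ν → (∀ i → lookup μ i ≡ + 0 → lookup ν i ≡ + 0) →
              ∀ i → lookup ν i ≡ + 0 → lookup μ i ≡ + 0
    minimal ν Dν nzν zeros⊆ i νi≡0 with refl ← dependency-zero-unique ν Dν nzν (zeros⊆ a μa≡0) νi≡0 = μa≡0

  sum-neg : ∀ {n} (f : Fin n → ℤ) → sumZ (tabulate (λ i → - f i)) ≡ - sumZ (tabulate f)
  sum-neg {zero} f = refl
  sum-neg {suc n} f = trans (cong (λ s → - f zero + s) (sum-neg (f ∘ suc))) (sym (ℤ.neg-distrib-+ (f zero) _))

  IsDependency-neg : ∀ μ → IsDependency μ → IsDependency (map -_ μ)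
  IsDependency-neg μ D k = begin
    sumZ (tabulate λ i → lookup (map -_ μ) i * momentVec i k)   ≡⟨ cong sumZ (tabulate-cong negate) ⟩
    sumZ (tabulate λ i → - (lookup μ i * momentVec i k))        ≡⟨ sum-neg (λ i → lookup μ i * momentVec i k) ⟩
    - sumZ (tabulate λ i → lookup μ i * momentVec i k)          ≡⟨ cong -_ (D k) ⟩
    + 0                                                         ∎
    where
    open ≡-Reasoning
    negate : ∀ i → lookup (map -_ μ) i * momentVec i k ≡ - (lookup μ i * momentVec i k)
    negate i = trans (cong (_* momentVec i k) (lookup-map i -_ μ))
                     (sym (ℤ.neg-distribˡ-* (lookup μ i) (momentVec i k)))

  -- kernel a is a dependency among the moment vectors other than the a-th
  kernel : Fin 6 → Vec ℤ 6
  kernel zero = + 0 ∷ + 1 ∷ -[1+ 3 ] ∷ + 6 ∷ -[1+ 3 ] ∷ + 1 ∷ []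
  kernel (suc zero) = + 1 ∷ + 0 ∷ -[1+ 9 ] ∷ + 20 ∷ -[1+ 14 ] ∷ + 4 ∷ []
  kernel (suc (suc zero)) = + 2 ∷ -[1+ 4 ] ∷ + 0 ∷ + 10 ∷ -[1+ 9 ] ∷ + 3 ∷ []
  kernel (suc (suc (suc zero))) = + 3 ∷ -[1+ 9 ] ∷ + 10 ∷ + 0 ∷ -[1+ 4 ] ∷ + 2 ∷ []
  kernel (suc (suc (suc (suc zero)))) = + 4 ∷ -[1+ 14 ] ∷ + 20 ∷ -[1+ 9 ] ∷ + 0 ∷ + 1 ∷ []
  kernel (suc (suc (suc (suc (suc zero))))) = + 1 ∷ -[1+ 3 ] ∷ + 6 ∷ -[1+ 3 ] ∷ + 1 ∷ + 0 ∷ []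

  IsPositiveKernel : Fin 6 → Set
  IsPositiveKernel a =
    IsDependency (kernel a) × lookup (kernel a) a ≡ + 0 × signℤ (lookup (kernel a) (punchIn a zero)) ≡ ＋

  opaque
    kernel-positive : ∀ a → IsPositiveKernel a
    kernel-positive = from-yes (all? λ a →
      all? (λ k → sumZ (tabulate λ i → lookup (kernel a) i * momentVec i k) ℤ.≟ + 0) ×-dec
      lookup (kernel a) a ℤ.≟ + 0 ×-dec
      signℤ (lookup (kernel a) (punchIn a zero)) ≟ˢ ＋)

  C64-of-dependency : ∀ μ {a s} → IsDependency μ → lookup μ a ≡ + 0 →
                      signℤ (lookup μ (punchIn a zero)) ≡ s → s ≢ 𝟘 →
                      C64 (scale s (alternatingCircuit a))
  C64-of-dependency μ {a} D μa≡0 refl s≢𝟘 =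
    μ , minimal-if-vanishing μ D (punchIn a zero , s≢𝟘 ∘ cong signℤ) μa≡0 , sym (dependency-signs μ D μa≡0)

  C64-scaled : ∀ a {s} → s ≢ 𝟘 → C64 (scale s (alternatingCircuit a))
  C64-scaled a {＋} _ with D , κa≡0 , κ↑≡＋ ← kernel-positive a =
    C64-of-dependency (kernel a) D κa≡0 κ↑≡＋ λ ()
  C64-scaled a {−} _ with D , κa≡0 , κ↑≡＋ ← kernel-positive a =
    C64-of-dependency (map -_ (kernel a)) (IsDependency-neg (kernel a) D)
      (trans (lookup-map a -_ (kernel a)) (cong -_ κa≡0))
      (trans (cong signℤ (lookup-map (punchIn a zero) -_ (kernel a))) (trans (signℤ-neg _) (cong neg κ↑≡＋)))
      λ ()
  C64-scaled a {𝟘} 𝟘≢𝟘 = ⊥-elim (𝟘≢𝟘 refl)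

  -- A minimal dependency without zeros would be dominated by kernel 0.
  C64-circuit : ∀ {V} → C64 V → ∃₂ λ a s → s ≢ 𝟘 × V ≡ scale s (alternatingCircuit a)
  C64-circuit (μ , (D , nz , minimal) , refl) with any? (λ i → lookup μ i ℤ.≟ + 0)
  ... | yes (a , μa≡0) = a , _ , leading-sign-nonzero μ D nz μa≡0 , dependency-signs μ D μa≡0
  ... | no no-zero with D₀ , κ₀≡0 , _ ← kernel-positive zero =
    ⊥-elim (no-zero (zero , minimal (kernel zero) D₀ (suc zero , λ ()) (λ i μi≡0 → ⊥-elim (no-zero (i , μi≡0)))
                                    zero κ₀≡0))

open Alternating

-- Ranking a transitive tournament

injective⇒surjective : ∀ {n} (f : Fin n → Fin n) → Injective _≡_ _≡_ f → ∀ k → ∃ λ i → f i ≡ k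
injective⇒surjective {suc m} f f-injective k with any? (λ i → f i Fin.≟ k)
... | yes hit = hit
... | no miss = ⊥-elim (ℕ.<-irrefl refl (injective⇒≤ {f = f′} f′-injective))
  where
  missed : ∀ i → k ≢ f i
  missed i k≡fi = miss (i , sym k≡fi)
  f′ : Fin (suc m) → Fin m
  f′ i = punchOut (missed i)
  f′-injective : Injective _≡_ _≡_ f′
  f′-injective {i} {j} = f-injective ∘ punchOut-injective (missed i) (missed j)

permutation : ∀ {n} (f : Fin n → Fin n) → Injective _≡_ _≡_ f → Fin n ↔ Fin n
permutation f f-injective =
  mk↔ₛ′ f (proj₁ ∘ surjective) (proj₂ ∘ surjective) (λ i → f-injective (proj₂ (surjective (f i))))
  where surjective = injective⇒surjective f f-injective

order-sign : ∀ {n} → Fin n → Fin n → Sign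
order-sign p q = if does (p Fin.<? q) then ＋ else −

-- A transitive tournament is ranked by counting, for each player, the players that beat it.
module Ranking {n : ℕ} (T : Fin n → Fin n → Sign)
  (T-diagonal : ∀ a → T a a ≡ 𝟘)
  (T-nonzero : ∀ {a b : Fin n} → a ≢ b → T a b ≢ 𝟘)
  (T-antisym : ∀ a b → T a b ≡ neg (T b a))
  (T-trans : ∀ {a b c : Fin n} → T a b ≡ ＋ → T b c ≡ ＋ → T a c ≡ ＋)
  where

  private
    isPositive : Sign → Bool
    isPositive ＋ = true
    isPositive _ = false

  beaters : Fin n → Subset n
  beaters a = tabulate (λ c → isPositive (T c a))

  ∈-beaters : ∀ {a c} → T c a ≡ ＋ → c ∈ beaters a
  ∈-beaters {a} {c} Tca≡＋ = lookup⇒[]= c (beaters a) (trans (lookup∘tabulate _ c) (cong isPositive Tca≡＋))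

  ∈-beaters⁻ : ∀ {a c} → c ∈ beaters a → T c a ≡ ＋
  ∈-beaters⁻ {a} {c} c∈ = positive (trans (sym (lookup∘tabulate _ c)) ([]=⇒lookup c∈))
    where
    positive : ∀ {x} → isPositive x ≡ true → x ≡ ＋
    positive {＋} _ = refl

  ∉-beaters-self : ∀ a → a ∉ beaters a
  ∉-beaters-self a a∈ with () ← trans (sym (T-diagonal a)) (∈-beaters⁻ a∈)

  rank : Fin n → Fin n
  rank a = fromℕ< (∣p∣<n (∉-beaters-self a))

  toℕ-rank : ∀ a → toℕ (rank a) ≡ ∣ beaters a ∣
  toℕ-rank a = toℕ-fromℕ< (∣p∣<n (∉-beaters-self a))

  rank-mono : ∀ {a b} → T a b ≡ ＋ → rank a Fin.< rank b
  rank-mono {a} {b} Tab≡＋ = subst₂ ℕ._<_ (sym (toℕ-rank a)) (sym (toℕ-rank b))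
    (p⊂q⇒∣p∣<∣q∣ ((λ c∈ → ∈-beaters (T-trans (∈-beaters⁻ c∈) Tab≡＋)) , a , ∈-beaters Tab≡＋ , ∉-beaters-self a))

  T-swap : ∀ {a b} → T a b ≡ − → T b a ≡ ＋
  T-swap {a} {b} Tab≡− = trans (T-antisym b a) (cong neg Tab≡−)

  rank-injective : Injective _≡_ _≡_ rank
  rank-injective {a} {b} ra≡rb with a Fin.≟ b
  ... | yes a≡b = a≡b
  ... | no a≢b with T a b in Tab
  ...   | ＋ = ⊥-elim (ℕ.<-irrefl (cong toℕ ra≡rb) (rank-mono Tab))
  ...   | − = ⊥-elim (ℕ.<-irrefl (cong toℕ (sym ra≡rb)) (rank-mono (T-swap Tab)))
  ...   | 𝟘 = ⊥-elim (T-nonzero a≢b Tab)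

  rank-order : ∀ {a b} → a ≢ b → T a b ≡ order-sign (rank a) (rank b)
  rank-order {a} {b} a≢b with T a b in Tab
  ... | ＋ rewrite dec-true (rank a Fin.<? rank b) (rank-mono Tab) = refl
  ... | − rewrite dec-false (rank a Fin.<? rank b) (ℕ.<-asym (rank-mono (T-swap Tab))) = refl
  ... | 𝟘 = ⊥-elim (T-nonzero a≢b Tab)

flipIf-· : ∀ b s x → flipIf b (s · x) ≡ s · flipIf b x
flipIf-· true s x = sym (neg-·ʳ s x)
flipIf-· false s x = refl

isNegative : Sign → Bool
isNegative − = true
isNegative _ = false

flipIf-isNegative : ∀ {f} x → f ≢ 𝟘 → flipIf (isNegative f) x ≡ x · f
flipIf-isNegative {−} x _ = refl
flipIf-isNegative {𝟘} x 𝟘≢𝟘 = ⊥-elim (𝟘≢𝟘 refl)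
flipIf-isNegative {＋} x _ = refl

flipIf-injective : ∀ b {x y} → flipIf b x ≡ flipIf b y → x ≡ y
flipIf-injective true {x} {y} e = trans (sym (neg-involutive x)) (trans (cong neg e) (neg-involutive y))
flipIf-injective false e = e

module _ {m : ℕ} (A : Subset m) (σ : Fin m ↔ Fin m) where
  open Inverse σ using (to; from; strictlyInverseʳ)

  lookup-reorientRelabel : ∀ X j →
                           lookup (reorientRelabel A σ X) j ≡ flipIf (lookup A (from j)) (lookup X (from j))
  lookup-reorientRelabel X = lookup∘tabulate _

  reorientRelabel-scale : ∀ s X → reorientRelabel A σ (scale s X) ≡ scale s (reorientRelabel A σ X)
  reorientRelabel-scale s X = lookup-extensional λ j → let b = lookup A (from j) in begin
    lookup (reorientRelabel A σ (scale s X)) j            ≡⟨ lookup-reorientRelabel (scale s X) j ⟩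
    flipIf b (lookup (scale s X) (from j))                ≡⟨ cong (flipIf b) (lookup-scale s X (from j)) ⟩
    flipIf b (s · lookup X (from j))                      ≡⟨ flipIf-· b s _ ⟩
    s · flipIf b (lookup X (from j))                      ≡⟨ cong (s ·_) (sym (lookup-reorientRelabel X j)) ⟩
    s · lookup (reorientRelabel A σ X) j                  ≡⟨ sym (lookup-scale s (reorientRelabel A σ X) j) ⟩
    lookup (scale s (reorientRelabel A σ X)) j            ∎
    where open ≡-Reasoning

  reorientRelabel-injective : ∀ {X X′} → reorientRelabel A σ X ≡ reorientRelabel A σ X′ → X ≡ X′
  reorientRelabel-injective {X} {X′} eq = lookup-extensional λ i →
    subst (λ k → lookup X k ≡ lookup X′ k) (strictlyInverseʳ i)
      (flipIf-injective (lookup A (from (to i))) (trans (sym (lookup-reorientRelabel X (to i)))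
                                 (trans (cong (λ V → lookup V (to i)) eq) (lookup-reorientRelabel X′ (to i)))))

-- Uniform oriented matroids of rank 4 on six elements

opaque
  alternatingCircuit-shift : ∀ p q →
                             p ≡ q ⊎ lookup (alternatingCircuit (suc p)) (suc q) ≡ parity q · order-sign p q
  alternatingCircuit-shift = from-yes (all? λ p → all? λ q →
    p Fin.≟ q ⊎-dec lookup (alternatingCircuit (suc p)) (suc q) ≟ˢ parity q · order-sign p q)

  punctured : ∀ (a : Fin 6) → a ∉ ⊤ ∖ a × ∣ ⊤ ∖ a ∣ ≡ 5
  punctured = from-yes (all? λ a → ¬? (a ∈? ⊤ {6} ∖ a) ×-dec ∣ ⊤ {6} ∖ a ∣ ℕ.≟ 5)

module UniformRank4On6 {𝒟 : SetOfSignVecs 6} (U : IsUniformOM 4 𝒟) where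
  open IsUniformOM U

  Y : Fin 6 → SignVec 6
  Y a = proj₁ (circuit-on (⊤ ∖ a) (proj₂ (punctured a)))

  Y-circuit : ∀ a → 𝒟 (Y a)
  Y-circuit a = proj₁ (proj₂ (circuit-on (⊤ ∖ a) (proj₂ (punctured a))))

  Y-support : ∀ a → supp (Y a) ≡ ⊤ ∖ a
  Y-support a = proj₂ (proj₂ (circuit-on (⊤ ∖ a) (proj₂ (punctured a))))

  Y-vanishes : ∀ a → lookup (Y a) a ≡ 𝟘
  Y-vanishes a = ∉-supp⁻ {X = Y a} (subst (a ∉_) (sym (Y-support a)) (proj₁ (punctured a)))

  Y-nonzero : ∀ a i → i ≢ a → lookup (Y a) i ≢ 𝟘
  Y-nonzero a i i≢a = ∈-supp⁻ {X = Y a} (subst (_ ∈_) (sym (Y-support a)) (x∈p∧x≢y⇒x∈p-y ∈⊤ i≢a))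

  circuit-vanishing : ∀ {Z a} → 𝒟 Z → lookup Z a ≡ 𝟘 → ∃ λ s → s ≢ 𝟘 × Z ≡ scale s (Y a)
  circuit-vanishing {Z} {a} 𝒟Z Za≡𝟘 with C2 (Y a) Z (Y-circuit a) 𝒟Z Ya⊑Z
    where
    Z⊆Ya : supp Z ⊆ supp (Y a)
    Z⊆Ya {i} i∈Z = subst (i ∈_) (sym (Y-support a))
      (x∈p∧x≢y⇒x∈p-y ∈⊤ λ { refl → ∈-supp⁻ {X = Z} i∈Z Za≡𝟘 })
    Ya⊑Z : Y a ⊑ Z
    Ya⊑Z = supp⊆⇒⊑ {X = Y a} {Z}
      (⊆-by-size Z⊆Ya (ℕ.≤-reflexive (trans (circuit-size (Y-circuit a)) (sym (circuit-size 𝒟Z)))))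
  ... | inj₁ Ya≡Z = ＋ , (λ ()) , trans (sym Ya≡Z) (sym (scale-identity (Y a)))
  ... | inj₂ Ya≡-Z =
    − , (λ ()) , trans (sym (negVec-involutive Z)) (trans (cong negVec (sym Ya≡-Z)) (sym (scale-neg (Y a))))

  circuit-has-zero : ∀ {Z} → 𝒟 Z → ∃ λ a → lookup Z a ≡ 𝟘
  circuit-has-zero {Z} 𝒟Z with any? (λ i → lookup Z i ≟ˢ 𝟘)
  ... | yes zero-entry = zero-entry
  ... | no no-zero =
    ⊥-elim (ℕ.<-irrefl refl (subst₂ ℕ._≤_ (∣⊤∣≡n 6) (circuit-size 𝒟Z) (p⊆q⇒∣p∣≤∣q∣ {p = ⊤} ⊤⊆Z)))
    where
    ⊤⊆Z : ⊤ ⊆ supp Z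
    ⊤⊆Z {i} _ = ∈-supp {X = Z} λ Zi≡𝟘 → no-zero (i , Zi≡𝟘)

  -- T a c compares Y (a + 1) with Y 0 at position c + 1, after normalising Y (a + 1) to be
  -- positive at position 0.
  T : Fin 5 → Fin 5 → Sign
  T a c = lookup (Y (suc a)) zero · lookup (Y (suc a)) (suc c) · lookup (Y zero) (suc c)

  T-diagonal : ∀ a → T a a ≡ 𝟘
  T-diagonal a = trans (cong (λ x → lookup (Y (suc a)) zero · x · lookup (Y zero) (suc a)) (Y-vanishes (suc a)))
                      (·-zeroˡ (lookup (Y zero) (suc a)))

  T-nonzero : ∀ {a c} → a ≢ c → T a c ≢ 𝟘
  T-nonzero {a} {c} a≢c =
    ·-nonzero (·-nonzero (Y-nonzero (suc a) zero λ ()) (Y-nonzero (suc a) (suc c) (a≢c ∘ sym ∘ suc-injective)))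
              (Y-nonzero zero (suc c) λ ())

  -- Eliminating position 0 between Y (a + 1) and −Y (b + 1), normalised to be positive and
  -- negative there, leaves a multiple ε of Y 0; conformality at each position c + 1 pins ε down.
  module _ {a b : Fin 5} (a≢b : a ≢ b) where
    private
      sa = lookup (Y (suc a)) zero
      sb = lookup (Y (suc b)) zero
      r : Fin 5 → Sign
      r c = lookup (Y zero) (suc c)
      sa≢𝟘 : sa ≢ 𝟘
      sa≢𝟘 = Y-nonzero (suc a) zero λ ()
      sb≢𝟘 : sb ≢ 𝟘
      sb≢𝟘 = Y-nonzero (suc b) zero λ ()
      P N : SignVec 6
      P = scale sa (Y (suc a))
      N = scale (neg sb) (Y (suc b))
      P₀≡＋ : lookup P zero ≡ ＋
      P₀≡＋ = trans (lookup-scale sa (Y (suc a)) zero) (·-self sa≢𝟘)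
      N₀≡− : lookup N zero ≡ −
      N₀≡− = trans (lookup-scale (neg sb) (Y (suc b)) zero) (trans (neg-·ˡ sb sb) (cong neg (·-self sb≢𝟘)))
      P≢-N : P ≢ negVec N
      P≢-N P≡-N = neg-nonzero (·-nonzero (neg-nonzero sb≢𝟘) (Y-nonzero (suc b) (suc a) (a≢b ∘ suc-injective)))
        (begin
        neg (neg sb · lookup (Y (suc b)) (suc a)) ≡⟨ cong neg (sym (lookup-scale (neg sb) (Y (suc b)) (suc a))) ⟩
        neg (lookup N (suc a))                    ≡⟨ sym (lookup-map (suc a) neg N) ⟩
        lookup (negVec N) (suc a)                 ≡⟨ cong (λ V → lookup V (suc a)) (sym P≡-N) ⟩
        lookup P (suc a)                          ≡⟨ lookup-scale sa (Y (suc a)) (suc a) ⟩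
        sa · lookup (Y (suc a)) (suc a)           ≡⟨ cong (sa ·_) (Y-vanishes (suc a)) ⟩
        𝟘                                         ∎)
        where open ≡-Reasoning

    eliminant : ∃ λ ε → ε ≢ 𝟘 × ∀ c → ε ≡ T a c ⊎ ε ≡ neg (T b c)
    eliminant
      with Z , 𝒟Z , Z₀≡𝟘 , pos , negative
             ← C3 P N zero (scale-circuit isOrientedMatroid sa≢𝟘 (Y-circuit (suc a)))
                           (scale-circuit isOrientedMatroid (neg-nonzero sb≢𝟘) (Y-circuit (suc b))) P≢-N P₀≡＋ N₀≡−
      with ε , ε≢𝟘 , refl ← circuit-vanishing 𝒟Z Z₀≡𝟘
      = ε , ε≢𝟘 , λ c → Sum.map (towards-P c) (towards-N c)
                          (conformal-entry {X = P} {N} {scale ε (Y zero)} pos negative (suc c) (Z-nonzero c))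
      where
      Z-nonzero : ∀ c → lookup (scale ε (Y zero)) (suc c) ≢ 𝟘
      Z-nonzero c =
        subst (_≢ 𝟘) (sym (lookup-scale ε (Y zero) (suc c))) (·-nonzero ε≢𝟘 (Y-nonzero zero (suc c) λ ()))
      towards : ∀ c x k → lookup (scale ε (Y zero)) (suc c) ≡ lookup (scale x (Y k)) (suc c) →
                ε ≡ x · lookup (Y k) (suc c) · r c
      towards c x k eq = ·-cancelʳ (r c) (Y-nonzero zero (suc c) λ ())
        (trans (sym (lookup-scale ε (Y zero) (suc c))) (trans eq (lookup-scale x (Y k) (suc c))))
      towards-P : ∀ c → lookup (scale ε (Y zero)) (suc c) ≡ lookup P (suc c) → ε ≡ T a c
      towards-P c = towards c sa (suc a)
      towards-N : ∀ c → lookup (scale ε (Y zero)) (suc c) ≡ lookup N (suc c) → ε ≡ neg (T b c)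
      towards-N c eq = trans (towards c (neg sb) (suc b) eq)
                             (trans (cong (_· r c) (neg-·ˡ sb (lookup (Y (suc b)) (suc c)))) (neg-·ˡ _ (r c)))

  private
    eliminant-values : ∀ {a b ε} → ε ≢ 𝟘 → (∀ c → ε ≡ T a c ⊎ ε ≡ neg (T b c)) → ε ≡ T a b × ε ≡ neg (T b a)
    eliminant-values {a} {b} {ε} ε≢𝟘 pins = at-b (pins b) , at-a (pins a)
      where
      at-b : ε ≡ T a b ⊎ ε ≡ neg (T b b) → ε ≡ T a b
      at-b (inj₁ ε≡Tab) = ε≡Tab
      at-b (inj₂ ε≡-Tbb) = ⊥-elim (ε≢𝟘 (trans ε≡-Tbb (cong neg (T-diagonal b))))
      at-a : ε ≡ T a a ⊎ ε ≡ neg (T b a) → ε ≡ neg (T b a)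
      at-a (inj₁ ε≡Taa) = ⊥-elim (ε≢𝟘 (trans ε≡Taa (T-diagonal a)))
      at-a (inj₂ ε≡-Tba) = ε≡-Tba

  T-antisym : ∀ a b → T a b ≡ neg (T b a)
  T-antisym a b with a Fin.≟ b
  ... | yes refl = trans (T-diagonal a) (cong neg (sym (T-diagonal a)))
  ... | no a≢b with ε , ε≢𝟘 , pins ← eliminant a≢b =
    let ε≡Tab , ε≡-Tba = eliminant-values ε≢𝟘 pins in trans (sym ε≡Tab) ε≡-Tba

  T-trans : ∀ {a b c} → T a b ≡ ＋ → T b c ≡ ＋ → T a c ≡ ＋
  T-trans {a} {b} {c} Tab≡＋ Tbc≡＋ with a Fin.≟ c
  ... | yes refl with () ← trans (sym Tab≡＋) (trans (T-antisym a b) (cong neg Tbc≡＋))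
  ... | no a≢c with ε , ε≢𝟘 , pins ← eliminant a≢c with pins b
  ...   | inj₁ ε≡Tab = trans (sym (proj₁ (eliminant-values ε≢𝟘 pins))) (trans ε≡Tab Tab≡＋)
  ...   | inj₂ ε≡-Tcb =
    trans (sym (proj₁ (eliminant-values ε≢𝟘 pins))) (trans ε≡-Tcb (trans (sym (T-antisym b c)) Tbc≡＋))

  open Ranking T T-diagonal T-nonzero T-antisym T-trans using (rank; rank-injective; rank-order)

  relabel : Fin 6 → Fin 6
  relabel zero = zero
  relabel (suc b) = suc (rank b)

  relabel-injective : ∀ {i j} → relabel i ≡ relabel j → i ≡ j
  relabel-injective {zero} {zero} _ = refl
  relabel-injective {suc i} {suc j} eq = cong suc (rank-injective (suc-injective eq))

  σ : Fin 6 ↔ Fin 6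
  σ = permutation relabel relabel-injective

  -- Position c + 1 is reoriented so that Y 0 becomes the alternating circuit vanishing at 0;
  -- Y a then becomes rescaling a times an alternating circuit (Y-normal-form).
  reorientationSign : Fin 6 → Sign
  reorientationSign zero = ＋
  reorientationSign (suc c) = lookup (Y zero) (suc c) · parity (rank c)

  rescaling : Fin 6 → Sign
  rescaling zero = ＋
  rescaling (suc b) = lookup (Y (suc b)) zero

  reorientationSign-nonzero : ∀ i → reorientationSign i ≢ 𝟘
  reorientationSign-nonzero zero ()
  reorientationSign-nonzero (suc c) = ·-nonzero (Y-nonzero zero (suc c) λ ()) (parity-nonzero (rank c))

  rescaling-nonzero : ∀ a → rescaling a ≢ 𝟘
  rescaling-nonzero zero ()
  rescaling-nonzero (suc b) = Y-nonzero (suc b) zero λ ()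

  target : Fin 6 → SignVec 6
  target a = alternatingCircuit (relabel a)

  Y-normal-form-diagonal : ∀ b →
    lookup (Y (suc b)) (suc b) · reorientationSign (suc b) ≡
    rescaling (suc b) · lookup (target (suc b)) (suc (rank b))
  Y-normal-form-diagonal b = begin
    lookup (Y (suc b)) (suc b) · ρ   ≡⟨ cong (_· ρ) (Y-vanishes (suc b)) ⟩
    𝟘 · ρ                            ≡⟨ ·-zeroˡ ρ ⟩
    rescaling (suc b) · 𝟘            ≡⟨ cong (rescaling (suc b) ·_) (sym (insertAt-lookup (tabulate parity) (suc (rank b)) 𝟘)) ⟩
    rescaling (suc b) · lookup (target (suc b)) (suc (rank b)) ∎
    where
    open ≡-Reasoning
    ρ = reorientationSign (suc b)

  Y-normal-form-off-diagonal : ∀ {b c} → b ≢ c →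
    lookup (Y (suc b)) (suc c) · reorientationSign (suc c) ≡
    rescaling (suc b) · lookup (target (suc b)) (suc (rank c))
  Y-normal-form-off-diagonal {b} {c} b≢c = begin
    y · (r · p)                                ≡⟨ rearrange ⟩
    s · (p · T b c)                            ≡⟨ cong (λ x → s · (p · x)) (rank-order b≢c) ⟩
    s · (p · order-sign (rank b) (rank c))     ≡⟨ cong (s ·_) (sym shifted) ⟩
    s · lookup (target (suc b)) (suc (rank c)) ∎
    where
    open ≡-Reasoning
    s = lookup (Y (suc b)) zero
    y = lookup (Y (suc b)) (suc c)
    r = lookup (Y zero) (suc c)
    p = parity (rank c)
    shifted : lookup (target (suc b)) (suc (rank c)) ≡ p · order-sign (rank b) (rank c)
    shifted = [ (λ rb≡rc → ⊥-elim (b≢c (rank-injective rb≡rc))) , id ]′ (alternatingCircuit-shift (rank b) (rank c))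
    rearrange : y · (r · p) ≡ s · (p · (s · y · r))
    rearrange = sym (begin
      s · (p · (s · y · r))   ≡⟨ cong (s ·_) (·-comm p (s · y · r)) ⟩
      s · ((s · y · r) · p)   ≡⟨ cong (s ·_) (trans (·-assoc (s · y) r p) (·-assoc s y (r · p))) ⟩
      s · (s · (y · (r · p))) ≡⟨ sym (·-assoc s s (y · (r · p))) ⟩
      (s · s) · (y · (r · p)) ≡⟨ cong (_· (y · (r · p))) (·-self (Y-nonzero (suc b) zero λ ())) ⟩
      ＋ · (y · (r · p))      ≡⟨ ·-identityˡ (y · (r · p)) ⟩
      y · (r · p)             ∎)

  Y-normal-form : ∀ a i → lookup (Y a) i · reorientationSign i ≡ rescaling a · lookup (target a) (relabel i)
  Y-normal-form zero zero = Y-vanishes zero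
  Y-normal-form zero (suc c) = begin
    r · (r · p)                            ≡⟨ sym (·-assoc r r p) ⟩
    (r · r) · p                            ≡⟨ cong (_· p) (·-self (Y-nonzero zero (suc c) λ ())) ⟩
    ＋ · p                                 ≡⟨ cong (＋ ·_) (sym (lookup∘tabulate parity (rank c))) ⟩
    ＋ · lookup (tabulate parity) (rank c) ∎
    where
    open ≡-Reasoning
    r = lookup (Y zero) (suc c)
    p = parity (rank c)
  Y-normal-form (suc b) zero = refl
  Y-normal-form (suc b) (suc c) = by-cases (b Fin.≟ c)
    where
    -- by-cases rather than with: abstracting b ≟ c over this goal is very slow
    by-cases : Dec (b ≡ c) → lookup (Y (suc b)) (suc c) · reorientationSign (suc c) ≡
                             rescaling (suc b) · lookup (target (suc b)) (suc (rank c))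
    by-cases (yes refl) = Y-normal-form-diagonal b
    by-cases (no b≢c) = Y-normal-form-off-diagonal b≢c

  reorientation : Subset 6
  reorientation = tabulate (isNegative ∘ reorientationSign)

  R : SignVec 6 → SignVec 6
  R = reorientRelabel reorientation σ

  R-Y : ∀ a → R (Y a) ≡ scale (rescaling a) (target a)
  R-Y a = lookup-extensional λ j → let i = Inverse.from σ j in begin
    lookup (R (Y a)) j
      ≡⟨ lookup-reorientRelabel reorientation σ (Y a) j ⟩
    flipIf (lookup reorientation i) (lookup (Y a) i)
      ≡⟨ cong (λ b → flipIf b (lookup (Y a) i)) (lookup∘tabulate (isNegative ∘ reorientationSign) i) ⟩
    flipIf (isNegative (reorientationSign i)) (lookup (Y a) i)
      ≡⟨ flipIf-isNegative (lookup (Y a) i) (reorientationSign-nonzero i) ⟩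
    lookup (Y a) i · reorientationSign i
      ≡⟨ Y-normal-form a i ⟩
    rescaling a · lookup (target a) (relabel i)
      ≡⟨ cong (λ k → rescaling a · lookup (target a) k) (Inverse.strictlyInverseˡ σ j) ⟩
    rescaling a · lookup (target a) j
      ≡⟨ sym (lookup-scale (rescaling a) (target a) j) ⟩
    lookup (scale (rescaling a) (target a)) j
      ∎
    where open ≡-Reasoning

  R-scaled-Y : ∀ s a → R (scale s (Y a)) ≡ scale (s · rescaling a) (target a)
  R-scaled-Y s a = begin
    R (scale s (Y a))                     ≡⟨ reorientRelabel-scale reorientation σ s (Y a) ⟩
    scale s (R (Y a))                     ≡⟨ cong (scale s) (R-Y a) ⟩
    scale s (scale (rescaling a) (target a)) ≡⟨ scale-scale s (rescaling a) (target a) ⟩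
    scale (s · rescaling a) (target a)    ∎
    where open ≡-Reasoning

  to-C64 : ∀ {X} → 𝒟 X → C64 (R X)
  to-C64 𝒟X =
    let a , Xa≡𝟘 = circuit-has-zero 𝒟X
        s , s≢𝟘 , X≡sYa = circuit-vanishing 𝒟X Xa≡𝟘
    in subst C64 (sym (trans (cong R X≡sYa) (R-scaled-Y s a)))
             (C64-scaled (relabel a) (·-nonzero s≢𝟘 (rescaling-nonzero a)))

  from-C64 : ∀ {X} → C64 (R X) → 𝒟 X
  from-C64 {X} c =
    let b , s , s≢𝟘 , RX≡sAb = C64-circuit c
        a = Inverse.from σ b
        ε = rescaling a
        ε·ε≡＋ = ·-self (rescaling-nonzero a)
    in subst 𝒟 (reorientRelabel-injective reorientation σ (begin
      R (scale (s · ε) (Y a))         ≡⟨ R-scaled-Y (s · ε) a ⟩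
      scale (s · ε · ε) (target a)    ≡⟨ cong₂ scale (trans (·-assoc s ε ε) (cong (s ·_) ε·ε≡＋))
                                                     (cong alternatingCircuit (Inverse.strictlyInverseˡ σ b)) ⟩
      scale s (alternatingCircuit b)  ≡⟨ sym RX≡sAb ⟩
      R X                             ∎))
      (scale-circuit isOrientedMatroid (·-nonzero s≢𝟘 (rescaling-nonzero a)) (Y-circuit a))
    where open ≡-Reasoning

  isomorphic : Isomorphic 𝒟 C64
  isomorphic = reorientation , σ , λ X → mk⇔ to-C64 from-C64

-- imported only here, since inside Alternating _+_ is integer addition
open import Data.Nat using (_+_)

lemma11p3 : (n d : ℕ) (M : OrientedMatroid n) → IsUniformOfRank d M →
    4 ≤ d → d + 2 ≤ n →
    Σ (SetOfSignVecs 6) λ 𝒟 → IsMinor (Circuit M) 𝒟 × Isomorphic 𝒟 C64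
lemma11p3 n d M uniform 4≤d d+2≤n =
  let 𝒟₁ , M≻𝒟₁ , U₁ = corank2-minor (subst (_≤ n) (ℕ.+-comm d 2) d+2≤n)
                                      (record { isOrientedMatroid = isOM M ; isUniform = uniform })
      𝒟 , 𝒟₁≻𝒟 , U = rank4-minor 4≤d U₁
  in 𝒟 , IsMinor-trans M≻𝒟₁ 𝒟₁≻𝒟 , UniformRank4On6.isomorphic U
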